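{- Let $(E,+,{}',0,1)$ be a lattice effect algebra with induced order $\leq$ and join $\vee$, and define $x\rightarrow y:=y+(x\vee y)'$ for all $x,y\in E$. Then the following identities hold for all $x,y\in E$: (i) $x\rightarrow0=x'$; (ii) $1\rightarrow x=x$; (iii) $x\rightarrow(y\rightarrow x)=1$; (iv) $(x\rightarrow y)\rightarrow y=x\vee y$; (v) $((x\rightarrow y)\rightarrow y)\rightarrow y=x\rightarrow y$; (vi) $x\rightarrow((x\rightarrow y)\rightarrow y)=1$; (vii) $y\rightarrow((x\rightarrow y)\rightarrow y)=1$; (viii) $y'\rightarrow((x\rightarrow y)\rightarrow y)'=x\rightarrow y$.
   Context: An effect algebra is a structure $(E,+,{}',0,1)$ where $E$ is a set, ${}'$ is a unary operation on $E$, $0,1\in E$, and $+$ is a partial binary operation on $E$ such that for all $x,y,z\in E$: (E1) if $x+y$ is defined then so is $y+x$ and $x+y=y+x$; (E2) $(x+y)+z$ is defined if and only if $x+(y+z)$ is defined, and then they are equal; (E3) $x+y$ is defined and equals $1$ if and only if $y=x'$; (E4) if $1+x$ is defined then $x=0$. The induced order is defined by $x\leq y$ iff there exists $z\in E$ with $x+z=y$; it is a partial order with least element $0$ and greatest element $1$. The effect algebra is a lattice effect algebra if $(E,\leq)$ is a lattice; $\vee$ and $\wedge$ denote its join and meet. -}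

module Defs where

open import Level using (Level; suc; _⊔_)
open import Data.Maybe using (Maybe; just; nothing; _>>=_)
open import Data.Product using (Σ; ∃; _×_; _,_)
open import Relation.Binary.PropositionalEquality using (_≡_)

-- An effect algebra (E, +, ', 0, 1). The partial operation + is modelled
-- as a total function into Maybe E: x ⊕ y ≡ nothing means "x + y undefined".
record EffectAlgebra (a : Level) : Set (suc a) where
  infixl 6 _⊕_
  field
    E    : Set a
    _⊕_  : E → E → Maybe E
    _′   : E → E
    𝟘 𝟙  : E
    comm  : ∀ x y z → x ⊕ y ≡ just z → y ⊕ x ≡ just z
    -- (E2) (x+y)+z defined iff x+(y+z) defined, and then equal
    assoc : ∀ x y z →
      ((x ⊕ y) >>= λ u → u ⊕ z) ≡ ((y ⊕ z) >>= λ v → x ⊕ v)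
    orth₁ : ∀ x y → x ⊕ y ≡ just 𝟙 → y ≡ x ′
    orth₂ : ∀ x → x ⊕ (x ′) ≡ just 𝟙
    zero-one : ∀ x z → 𝟙 ⊕ x ≡ just z → x ≡ 𝟘

  _≤_ : E → E → Set a
  x ≤ y = ∃ λ z → x ⊕ z ≡ just y

record LatticeEffectAlgebra (a : Level) : Set (suc a) where
  field
    effectAlgebra : EffectAlgebra a
  open EffectAlgebra effectAlgebra public
  field
    _∨_ _∧_ : E → E → E
    ∨-ub₁ : ∀ x y → x ≤ (x ∨ y)
    ∨-ub₂ : ∀ x y → y ≤ (x ∨ y)
    ∨-lub : ∀ x y z → x ≤ z → y ≤ z → (x ∨ y) ≤ z
    ∧-lb₁ : ∀ x y → (x ∧ y) ≤ x
    ∧-lb₂ : ∀ x y → (x ∧ y) ≤ y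
    ∧-glb : ∀ x y z → z ≤ x → z ≤ y → z ≤ (x ∧ y)

  imp : E → E → Maybe E
  imp x y = y ⊕ ((x ∨ y) ′)

  infixr 5 _⇒_
  _⇒_ : Maybe E → Maybe E → Maybe E
  m ⇒ n = m >>= λ x → n >>= λ y → imp x y

  _′ₘ : Maybe E → Maybe E
  m ′ₘ = m >>= λ x → just (x ′)

module Submission where

-- Since y ≤ x ∨ y, the sum x → y = y + (x ∨ y)′ is always defined, and its value u
-- satisfies y ≤ u and y + u′ = x ∨ y; this is (iv), (x → y) → y = x ∨ y. Every other
-- identity then reduces to one of two comparable cases of the arrow: x → y = 1 when
-- x ≤ y, and x → y = y + x′ when y ≤ x.

open import Defs
open import Level using (Level)
open import Data.Maybe using (just; nothing)
open import Data.Maybe.Properties using (just-injective)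
open import Data.Product using (_×_; _,_; ∃)
open import Relation.Binary.PropositionalEquality
  using (_≡_; refl; sym; trans; cong; subst; module ≡-Reasoning)

module EffectAlgebraProperties {a : Level} (𝓔 : EffectAlgebra a) where
  open EffectAlgebra 𝓔

  ⊕-comm : ∀ x y → x ⊕ y ≡ y ⊕ x
  ⊕-comm x y with x ⊕ y in exy
  ... | just z = sym (comm x y z exy)
  ... | nothing with y ⊕ x in eyx
  ...   | just z  = trans (sym exy) (comm y x z eyx)
  ...   | nothing = refl

  ⊕-regroupʳ : ∀ x y z {u w} → x ⊕ y ≡ just u → u ⊕ z ≡ just w →
               ∃ λ v → y ⊕ z ≡ just v × x ⊕ v ≡ just w
  ⊕-regroupʳ x y z exy euz with assoc x y z
  ... | e rewrite exy with y ⊕ z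
  ...   | just v  = v , refl , trans (sym e) euz
  ...   | nothing with () ← trans (sym euz) e

  ′-involutive : ∀ x → x ′ ′ ≡ x
  ′-involutive x = sym (orth₁ (x ′) x (comm x (x ′) 𝟙 (orth₂ x)))

  ′-injective : ∀ {x y} → x ′ ≡ y ′ → x ≡ y
  ′-injective {x} {y} e = trans (sym (′-involutive x)) (trans (cong _′ e) (′-involutive y))

  𝟙′≡𝟘 : 𝟙 ′ ≡ 𝟘
  𝟙′≡𝟘 = zero-one (𝟙 ′) 𝟙 (orth₂ 𝟙)

  ⊕-identityʳ : ∀ x → x ⊕ 𝟘 ≡ just x
  ⊕-identityʳ x = subst (λ t → t ⊕ 𝟘 ≡ just t) (′-involutive x) x′′⊕𝟘≡x′′
    where
    𝟙⊕𝟘≡𝟙 : 𝟙 ⊕ 𝟘 ≡ just 𝟙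
    𝟙⊕𝟘≡𝟙 = subst (λ t → 𝟙 ⊕ t ≡ just 𝟙) 𝟙′≡𝟘 (orth₂ 𝟙)

    x′′⊕𝟘≡x′′ : x ′ ′ ⊕ 𝟘 ≡ just (x ′ ′)
    x′′⊕𝟘≡x′′ with ⊕-regroupʳ (x ′) (x ′ ′) 𝟘 (orth₂ (x ′)) 𝟙⊕𝟘≡𝟙
    ... | v , e , x′⊕v≡𝟙 = subst (λ t → x ′ ′ ⊕ 𝟘 ≡ just t) (orth₁ (x ′) v x′⊕v≡𝟙) e

  ⊕-identityˡ : ∀ x → 𝟘 ⊕ x ≡ just x
  ⊕-identityˡ x = trans (⊕-comm 𝟘 x) (⊕-identityʳ x)

  -- Reading x + y = w as y = w ⊖ x, this is the identity (w ⊖ x) + w′ = x′.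
  ⊕-complementʳ : ∀ {x y w} → x ⊕ y ≡ just w → y ⊕ w ′ ≡ just (x ′)
  ⊕-complementʳ {x} {y} {w} exy with ⊕-regroupʳ x y (w ′) exy (orth₂ w)
  ... | v , eyw , x⊕v≡𝟙 = subst (λ t → y ⊕ w ′ ≡ just t) (orth₁ x v x⊕v≡𝟙) eyw

  ⊕-cancelˡ : ∀ {x y z w} → x ⊕ y ≡ just w → x ⊕ z ≡ just w → y ≡ z
  ⊕-cancelˡ {x} {y} {z} {w} exy exz = ′-injective (just-injective (trans (sym (w′⊕x≡′ exy)) (w′⊕x≡′ exz)))
    where
    w′⊕x≡′ : ∀ {t} → x ⊕ t ≡ just w → w ′ ⊕ x ≡ just (t ′)
    w′⊕x≡′ {t} ext = subst (λ s → w ′ ⊕ s ≡ just (t ′)) (′-involutive x)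
                       (⊕-complementʳ (⊕-complementʳ ext))

  ⊕≡𝟘⇒≡𝟘 : ∀ {x y} → x ⊕ y ≡ just 𝟘 → y ≡ 𝟘
  ⊕≡𝟘⇒≡𝟘 {x} {y} exy with ⊕-regroupʳ x y 𝟙 exy (⊕-identityˡ 𝟙)
  ... | t , y⊕𝟙≡t , _ = zero-one y t (trans (⊕-comm 𝟙 y) y⊕𝟙≡t)

  ≤-refl : ∀ x → x ≤ x
  ≤-refl x = 𝟘 , ⊕-identityʳ x

  ≤-antisym : ∀ {x y} → x ≤ y → y ≤ x → x ≡ y
  ≤-antisym {x} {y} (p , x⊕p≡y) (q , y⊕q≡x) with ⊕-regroupʳ x p q x⊕p≡y y⊕q≡x
  ... | v , p⊕q≡v , x⊕v≡x with ⊕-cancelˡ x⊕v≡x (⊕-identityʳ x)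
  ... | refl with ⊕≡𝟘⇒≡𝟘 (trans (⊕-comm q p) p⊕q≡v)
  ... | refl = just-injective (trans (sym (⊕-identityʳ x)) x⊕p≡y)

  𝟘≤ : ∀ x → 𝟘 ≤ x
  𝟘≤ x = x , ⊕-identityˡ x

  ≤𝟙 : ∀ x → x ≤ 𝟙
  ≤𝟙 x = x ′ , orth₂ x

  ′-antitone : ∀ {x y} → x ≤ y → (y ′) ≤ (x ′)
  ′-antitone {x} {y} (d , x⊕d≡y) = d , trans (⊕-comm (y ′) d) (⊕-complementʳ x⊕d≡y)

  -- For x ≤ y the sum x + y′ is defined, and its complement is y ⊖ x.
  ≤⇒⊕′-defined : ∀ {x y} → x ≤ y → ∃ λ u → x ⊕ y ′ ≡ just u × x ⊕ u ′ ≡ just y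
  ≤⇒⊕′-defined {x} {y} (d , x⊕d≡y)
    with ⊕-regroupʳ d (y ′) x (⊕-complementʳ x⊕d≡y) (comm x (x ′) 𝟙 (orth₂ x))
  ... | u , y′⊕x≡u , d⊕u≡𝟙 =
    u , trans (⊕-comm x (y ′)) y′⊕x≡u , subst (λ t → x ⊕ t ≡ just y) (orth₁ u d (comm d u 𝟙 d⊕u≡𝟙)) x⊕d≡y

module LatticeEffectAlgebraProperties {a : Level} (L : LatticeEffectAlgebra a) where
  open LatticeEffectAlgebra L
  open EffectAlgebraProperties effectAlgebra

  x≤y⇒x∨y≡y : ∀ {x y} → x ≤ y → x ∨ y ≡ y
  x≤y⇒x∨y≡y {x} {y} x≤y = ≤-antisym (∨-lub x y y x≤y (≤-refl y)) (∨-ub₂ x y)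

  y≤x⇒x∨y≡x : ∀ {x y} → y ≤ x → x ∨ y ≡ x
  y≤x⇒x∨y≡x {x} {y} y≤x = ≤-antisym (∨-lub x y x (≤-refl x) y≤x) (∨-ub₁ x y)

  x≤y⇒imp≡𝟙 : ∀ {x y} → x ≤ y → imp x y ≡ just 𝟙
  x≤y⇒imp≡𝟙 {x} {y} x≤y = trans (cong (λ t → y ⊕ t ′) (x≤y⇒x∨y≡y x≤y)) (orth₂ y)

  y≤x⇒imp≡y⊕x′ : ∀ {x y} → y ≤ x → imp x y ≡ y ⊕ x ′
  y≤x⇒imp≡y⊕x′ y≤x = cong (λ t → _ ⊕ t ′) (y≤x⇒x∨y≡x y≤x)

  imp-defined : ∀ x y → ∃ λ u → imp x y ≡ just u × y ⊕ u ′ ≡ just (x ∨ y)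
  imp-defined x y = ≤⇒⊕′-defined (∨-ub₂ x y)

  ≤-imp : ∀ {x y u} → imp x y ≡ just u → y ≤ u
  ≤-imp e = _ , e

  imp-imp : ∀ x y → (just x ⇒ just y) ⇒ just y ≡ just (x ∨ y)
  imp-imp x y with imp-defined x y
  ... | u , e , y⊕u′≡x∨y rewrite e = trans (y≤x⇒imp≡y⊕x′ (≤-imp e)) y⊕u′≡x∨y

theorem2p2 : ∀ {a : Level} (L : LatticeEffectAlgebra a) →
    let open LatticeEffectAlgebra L in
    ∀ (x y : E) →
      (just x ⇒ just 𝟘 ≡ just (x ′))
      × (just 𝟙 ⇒ just x ≡ just x)
      × (just x ⇒ (just y ⇒ just x) ≡ just 𝟙)
      × ((just x ⇒ just y) ⇒ just y ≡ just (x ∨ y))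
      × (((just x ⇒ just y) ⇒ just y) ⇒ just y ≡ just x ⇒ just y)
      × (just x ⇒ ((just x ⇒ just y) ⇒ just y) ≡ just 𝟙)
      × (just y ⇒ ((just x ⇒ just y) ⇒ just y) ≡ just 𝟙)
      × (just (y ′) ⇒ (((just x ⇒ just y) ⇒ just y) ′ₘ)
           ≡ just x ⇒ just y)
theorem2p2 L x y =
    trans (y≤x⇒imp≡y⊕x′ (𝟘≤ x)) (⊕-identityˡ (x ′))
  , trans (y≤x⇒imp≡y⊕x′ (≤𝟙 x)) (trans (cong (x ⊕_) 𝟙′≡𝟘) (⊕-identityʳ x))
  , x⇒[y⇒x]≡𝟙
  , imp-imp x y
  , trans (cong (_⇒ just y) (imp-imp x y)) (y≤x⇒imp≡y⊕x′ (∨-ub₂ x y))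
  , trans (cong (just x ⇒_) (imp-imp x y)) (x≤y⇒imp≡𝟙 (∨-ub₁ x y))
  , trans (cong (just y ⇒_) (imp-imp x y)) (x≤y⇒imp≡𝟙 (∨-ub₂ x y))
  , y′⇒[x∨y]′≡x⇒y
  where
  open LatticeEffectAlgebra L
  open EffectAlgebraProperties effectAlgebra
  open LatticeEffectAlgebraProperties L

  x⇒[y⇒x]≡𝟙 : just x ⇒ (just y ⇒ just x) ≡ just 𝟙
  x⇒[y⇒x]≡𝟙 with imp-defined y x
  ... | _ , e , _ rewrite e = x≤y⇒imp≡𝟙 (≤-imp e)

  y′⇒[x∨y]′≡x⇒y : just (y ′) ⇒ (((just x ⇒ just y) ⇒ just y) ′ₘ) ≡ just x ⇒ just y
  y′⇒[x∨y]′≡x⇒y = begin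
    just (y ′) ⇒ (((just x ⇒ just y) ⇒ just y) ′ₘ) ≡⟨ cong (λ m → just (y ′) ⇒ (m ′ₘ)) (imp-imp x y) ⟩
    imp (y ′) ((x ∨ y) ′)                           ≡⟨ y≤x⇒imp≡y⊕x′ (′-antitone (∨-ub₂ x y)) ⟩
    (x ∨ y) ′ ⊕ y ′ ′                               ≡⟨ cong ((x ∨ y) ′ ⊕_) (′-involutive y) ⟩
    (x ∨ y) ′ ⊕ y                                   ≡⟨ ⊕-comm ((x ∨ y) ′) y ⟩
    imp x y                                         ∎
    where open ≡-Reasoning
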